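{- Let $k>0$ be a real number. For every integer $n\ge 0$, $$\sum_{s=0}^{n}Q_{P_{k,s}}=\frac{1}{k+1}\Big[\,Q_{P_{k,n+1}}+k\,Q_{P_{k,n}}-Q_{P_{k,1}}+Q_{P_{k,0}}\,\Big].$$
   Context: Dual-complex numbers are expressions $x_1+i\,x_2+\varepsilon\,y_1+i\,\varepsilon\,y_2$ with $x_1,x_2,y_1,y_2$ real, forming the commutative ring $\mathbb{C}[\varepsilon]/(\varepsilon^2)$: $i^2=-1$, $\varepsilon\neq 0$, $\varepsilon^2=0$, $(i\varepsilon)^2=0$, with componentwise addition and real scalar multiplication. The $k$-Pell numbers are defined by $P_{k,0}=0$, $P_{k,1}=1$, $P_{k,n+1}=2P_{k,n}+kP_{k,n-1}$ for $n\ge1$. The dual-complex $k$-Pell quaternion is $Q_{P_{k,n}}=P_{k,n}+i\,P_{k,n+1}+\varepsilon\,P_{k,n+2}+i\,\varepsilon\,P_{k,n+3}$ for $n\ge 0$. -}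

module Defs where

open import Level using (Level)
open import Data.Nat using (ℕ; zero; suc)
open import Data.Product using (_×_; _,_)
open import Algebra.Bundles using (CommutativeRing)

-- Everything is developed over an arbitrary commutative ring R of scalars
-- (the paper uses R = ℝ).
module DualComplex {c ℓ : Level} (R : CommutativeRing c ℓ) where
  open CommutativeRing R hiding (zero)

  -- Dual-complex number  x₁ + i x₂ + ε y₁ + i ε y₂  with coefficients in R.
  record DC : Set c where
    constructor dc
    field
      x₁ x₂ y₁ y₂ : Carrier
  open DC public

  _≈ᵈ_ : DC → DC → Set ℓ
  a ≈ᵈ b = (x₁ a ≈ x₁ b) × (x₂ a ≈ x₂ b) × (y₁ a ≈ y₁ b) × (y₂ a ≈ y₂ b)

  _+ᵈ_ : DC → DC → DC
  a +ᵈ b = dc (x₁ a + x₁ b) (x₂ a + x₂ b) (y₁ a + y₁ b) (y₂ a + y₂ b)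

  -ᵈ_ : DC → DC
  -ᵈ a = dc (- x₁ a) (- x₂ a) (- y₁ a) (- y₂ a)

  _-ᵈ_ : DC → DC → DC
  a -ᵈ b = a +ᵈ (-ᵈ b)

  0ᵈ : DC
  0ᵈ = dc 0# 0# 0# 0#

  _·ᵈ_ : Carrier → DC → DC
  r ·ᵈ a = dc (r * x₁ a) (r * x₂ a) (r * y₁ a) (r * y₂ a)

  -- ring multiplication in ℂ[ε]/(ε²), i² = -1 (not needed by the statement)
  _*ᵈ_ : DC → DC → DC
  a *ᵈ b = dc (x₁ a * x₁ b - x₂ a * x₂ b)
              (x₁ a * x₂ b + x₂ a * x₁ b)
              (x₁ a * y₁ b - x₂ a * y₂ b + y₁ a * x₁ b - y₂ a * x₂ b)
              (x₁ a * y₂ b + x₂ a * y₁ b + y₁ a * x₂ b + y₂ a * x₁ b)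

  module Pell (k : Carrier) where
    P : ℕ → Carrier
    P zero = 0#
    P (suc zero) = 1#
    P (suc (suc n)) = (1# + 1#) * P (suc n) + k * P n

    Q : ℕ → DC
    Q n = dc (P n) (P (suc n)) (P (suc (suc n))) (P (suc (suc (suc n))))

    sumQ : ℕ → DC
    sumQ zero = Q zero
    sumQ (suc n) = sumQ n +ᵈ Q (suc n)

-- The quaternion Q n has the four components P n, P (n+1), P (n+2),
-- P (n+3), and addition and scalar multiplication act componentwise, so
-- the theorem is four instances of one scalar fact about any sequence f
-- satisfying the k-Pell recurrence f (m+2) = 2 f (m+1) + k f m over a
-- commutative ring:
--
--   (k + 1) · ∑_{s ≤ n} f s  =  f (n+1) + k f n − f 1 + f 0.
--
-- The proof is a telescoping argument: the quantity T n = f (n+1) + k f n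
-- increases by exactly (k + 1) f (n+1) from n to n+1 (by the recurrence),
-- so both sides above satisfy the same first-order recursion.  Dividing by
-- k + 1 (i.e. multiplying by the given inverse) yields the closed form,
-- and the main theorem applies it to the four shifted Pell sequences.
module Submission where

open import Defs
open import Level using (Level)
open import Data.Nat using (ℕ; suc; zero)
open import Data.Product using (_×_; _,_)
open import Algebra.Bundles using (CommutativeRing)
import Algebra.Solver.Ring.NaturalCoefficients.Default as NaturalSolver
import Relation.Binary.Reasoning.Setoid as SetoidReasoning

module PellSums {c ℓ : Level} (R : CommutativeRing c ℓ) where
  open CommutativeRing R hiding (zero)
  open NaturalSolver commutativeSemiring using (solve; _:=_; _:+_; _:*_)
  open SetoidReasoning setoid

  PellLike : Carrier → (ℕ → Carrier) → Set ℓ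
  PellLike k f = ∀ m → f (suc (suc m)) ≈ (1# + 1#) * f (suc m) + k * f m

  PartialSums : (ℕ → Carrier) → (ℕ → Carrier) → Set ℓ
  PartialSums f S = (S zero ≈ f zero) × (∀ m → S (suc m) ≈ S m + f (suc m))

  succ-distrib : ∀ a x → (a + 1#) * x ≈ a * x + x
  succ-distrib a x = trans (distribʳ x a 1#) (+-congˡ (*-identityˡ x))

  double : ∀ x → (1# + 1#) * x ≈ x + x
  double x = trans (distribʳ x 1# 1#) (+-cong (*-identityˡ x) (*-identityˡ x))

  telescope : Carrier → (ℕ → Carrier) → ℕ → Carrier
  telescope k f n = f (suc n) + k * f n

  telescope-step : ∀ k f → PellLike k f →
                   ∀ n → telescope k f (suc n) ≈ telescope k f n + (k + 1#) * f (suc n)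
  telescope-step k f pell n = begin
    f (suc (suc n)) + k * f (suc n)                     ≈⟨ +-congʳ (pell n) ⟩
    ((1# + 1#) * f (suc n) + k * f n) + k * f (suc n)   ≈⟨ +-congʳ (+-congʳ (double (f (suc n)))) ⟩
    ((f (suc n) + f (suc n)) + k * f n) + k * f (suc n) ≈⟨ regroup k (f n) (f (suc n)) ⟩
    (f (suc n) + k * f n) + (k * f (suc n) + f (suc n)) ≈⟨ +-congˡ (sym (succ-distrib k (f (suc n)))) ⟩
    (f (suc n) + k * f n) + (k + 1#) * f (suc n)        ∎
    where
    regroup : ∀ k a b → ((b + b) + k * a) + k * b ≈ (b + k * a) + (k * b + b)
    regroup = solve 3 (λ k a b → ((b :+ b) :+ k :* a) :+ k :* b
                                   := (b :+ k :* a) :+ (k :* b :+ b)) refl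

  scaled-sum : ∀ k f S → PellLike k f → PartialSums f S →
               ∀ n → (k + 1#) * S n ≈ (telescope k f n + - f 1) + f 0
  scaled-sum k f S pell (S₀ , _) zero = begin
    (k + 1#) * S zero                  ≈⟨ *-congˡ S₀ ⟩
    (k + 1#) * f 0                     ≈⟨ succ-distrib k (f 0) ⟩
    k * f 0 + f 0                      ≈⟨ sym (+-identityʳ _) ⟩
    (k * f 0 + f 0) + 0#               ≈⟨ +-congˡ (sym (-‿inverseʳ (f 1))) ⟩
    (k * f 0 + f 0) + (f 1 + - f 1)    ≈⟨ regroup k (f 0) (f 1) (- f 1) ⟩
    ((f 1 + k * f 0) + - f 1) + f 0    ∎
    where
    regroup : ∀ k a b b′ → (k * a + a) + (b + b′) ≈ ((b + k * a) + b′) + a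
    regroup = solve 4 (λ k a b b′ → (k :* a :+ a) :+ (b :+ b′)
                                      := ((b :+ k :* a) :+ b′) :+ a) refl
  scaled-sum k f S pell sums@(_ , S-step) (suc n) = begin
    (k + 1#) * S (suc n)                                   ≈⟨ *-congˡ (S-step n) ⟩
    (k + 1#) * (S n + f (suc n))                           ≈⟨ distribˡ (k + 1#) (S n) (f (suc n)) ⟩
    (k + 1#) * S n + (k + 1#) * f (suc n)                  ≈⟨ +-congʳ (scaled-sum k f S pell sums n) ⟩
    ((T n + - f 1) + f 0) + (k + 1#) * f (suc n)           ≈⟨ regroup (T n) (- f 1) (f 0) ((k + 1#) * f (suc n)) ⟩
    ((T n + (k + 1#) * f (suc n)) + - f 1) + f 0           ≈⟨ +-congʳ (+-congʳ (sym (telescope-step k f pell n))) ⟩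
    (T (suc n) + - f 1) + f 0                              ∎
    where
    T : ℕ → Carrier
    T = telescope k f
    regroup : ∀ t a b d → ((t + a) + b) + d ≈ ((t + d) + a) + b
    regroup = solve 4 (λ t a b d → ((t :+ a) :+ b) :+ d := ((t :+ d) :+ a) :+ b) refl

  sum-formula : ∀ k inv → inv * (k + 1#) ≈ 1# → ∀ f S → PellLike k f → PartialSums f S →
                ∀ n → S n ≈ inv * ((telescope k f n + - f 1) + f 0)
  sum-formula k inv inverse f S pell sums n = begin
    S n                       ≈⟨ sym (*-identityˡ (S n)) ⟩
    1# * S n                  ≈⟨ *-congʳ (sym inverse) ⟩
    (inv * (k + 1#)) * S n    ≈⟨ *-assoc inv (k + 1#) (S n) ⟩
    inv * ((k + 1#) * S n)    ≈⟨ *-congˡ (scaled-sum k f S pell sums n) ⟩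
    inv * ((telescope k f n + - f 1) + f 0) ∎

-- Each component of the quaternion sum is the partial sum of a shifted
-- k-Pell sequence; both the recurrence and the partial-sum equations hold
-- definitionally, so the scalar closed form applies componentwise.
mainTheorem2 : {c ℓ : Level} (R : CommutativeRing c ℓ) →
    let open CommutativeRing R in
    let open DualComplex R in
    (k inv : Carrier) → inv * (k + 1#) ≈ 1# →
    let open Pell k in
    (n : ℕ) →
    sumQ n ≈ᵈ (inv ·ᵈ (((Q (suc n) +ᵈ (k ·ᵈ Q n)) -ᵈ Q 1) +ᵈ Q 0))
mainTheorem2 R k inv inverse n =
    component (λ m → P m)                   (λ m → x₁ (sumQ m))
      (λ _ → refl) (refl , λ _ → refl)
  , component (λ m → P (suc m))             (λ m → x₂ (sumQ m))
      (λ _ → refl) (refl , λ _ → refl)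
  , component (λ m → P (suc (suc m)))       (λ m → y₁ (sumQ m))
      (λ _ → refl) (refl , λ _ → refl)
  , component (λ m → P (suc (suc (suc m)))) (λ m → y₂ (sumQ m))
      (λ _ → refl) (refl , λ _ → refl)
  where
  open CommutativeRing R hiding (zero)
  open DualComplex R
  open Pell k
  open PellSums R

  component : ∀ f S → PellLike k f → PartialSums f S →
              S n ≈ inv * ((telescope k f n + - f 1) + f 0)
  component f S pell sums = sum-formula k inv inverse f S pell sums n
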